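{- Let $\lambda\vdash n$ and let $M^\lambda$ be the complex vector space with basis the tabloids of shape $\lambda$. For $1\le i\le n-1$ define a linear operator $\overline{\pi}_i$ on $M^\lambda$ by, for each tabloid $\{t\}$: $\overline{\pi}_i\{t\}=0$ if $i$ and $i+1$ lie in the same row of $\{t\}$; $\overline{\pi}_i\{t\}=-\{t\}$ if $i$ lies in a lower row than $i+1$; and $\overline{\pi}_i\{t\}=s_i\{t\}$ if $i$ lies in a higher row than $i+1$. Then $\overline{\pi}_i\overline{\pi}_{i+1}\overline{\pi}_i=\overline{\pi}_{i+1}\overline{\pi}_i\overline{\pi}_{i+1}$ for every $1\le i\le n-2$.
   Context: A tabloid of shape $\lambda$ is an equivalence class of fillings of the Young diagram of $\lambda$ by $1,\dots,n$ (each once), two fillings being equivalent when each row contains the same set of letters. Diagrams are in French notation (row 1 at the bottom; "lower" means closer to the bottom). $s_i\{t\}$ is the tabloid obtained by swapping the letters $i$ and $i+1$. -}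

module Defs where

open import Level using (Level)
open import Algebra.Bundles using (CommutativeRing)
open import Data.Nat using (ℕ; zero; suc; _≤_; _<_)
open import Data.Nat.Properties using (<-trans; n<1+n)
open import Data.Fin using (Fin; fromℕ<)
import Data.Fin as F
open import Data.Fin.Properties using (_≟_; <-cmp)
open import Data.Fin.Permutation.Components using (transpose)
open import Data.Vec using (Vec; lookup; tabulate; count; sum)
open import Data.Vec.Properties using (≡-dec)
open import Data.List using (List; []; _∷_; [_]; concatMap; map)
open import Data.Product using (_×_; _,_)
open import Relation.Binary.Definitions using (tri<; tri≈; tri>)
open import Relation.Binary.PropositionalEquality using (_≡_)
open import Relation.Nullary using (yes; no)

IsPartition : {ℓ : ℕ} → Vec ℕ ℓ → ℕ → Set
IsPartition {ℓ} λ' n =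
  ((j k : Fin ℓ) → j F.≤ k → lookup λ' k ≤ lookup λ' j)
  × ((j : Fin ℓ) → 1 ≤ lookup λ' j)
  × (sum λ' ≡ n)

-- A tabloid with n letters and ℓ rows is encoded by its row function:
-- the vector whose entry at (0-based) letter x is the (0-based) row index
-- of x.  Row index 0 is the bottom row (French notation), so "lower row"
-- means "smaller row index".  Two fillings are equivalent iff they have the
-- same row function, so row functions are exactly tabloids.
RowFun : ℕ → ℕ → Set
RowFun ℓ n = Vec (Fin ℓ) n

IsTabloid : {ℓ n : ℕ} → Vec ℕ ℓ → RowFun ℓ n → Set
IsTabloid {ℓ} λ' t = (j : Fin ℓ) → count (_≟ j) t ≡ lookup λ' j

swapLetters : {ℓ n : ℕ} → Fin n → Fin n → RowFun ℓ n → RowFun ℓ n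
swapLetters a b t = tabulate (λ x → lookup t (transpose a b x))

module Tabloids {c ℓr : Level} (R : CommutativeRing c ℓr) (ℓ n : ℕ) where
  open CommutativeRing R

  -- Elements of the free R-module on tabloids (M^λ sits inside it as the
  -- span of tabloids of shape λ), as formal finite linear combinations.
  Comb : Set c
  Comb = List (Carrier × RowFun ℓ n)

  coeff : Comb → RowFun ℓ n → Carrier
  coeff [] w = 0#
  coeff ((a , t) ∷ v) w with ≡-dec _≟_ t w
  ... | yes _ = a + coeff v w
  ... | no  _ = coeff v w

  _≋_ : Comb → Comb → Set ℓr
  u ≋ v = (w : RowFun ℓ n) → coeff u w ≈ coeff v w

  basis : RowFun ℓ n → Comb
  basis t = [ (1# , t) ]

  -- π̄ on a basis tabloid {t}, acting on the (0-based) letters i and i+1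
  -- (paper's letters i+1 and i+2):
  --   same row → 0;  i lower than i+1 → -{t};  i higher than i+1 → s{t}.
  πbarBasis : (i : ℕ) → suc i < n → RowFun ℓ n → Comb
  πbarBasis i p t with <-cmp (lookup t (fromℕ< (<-trans (n<1+n i) p))) (lookup t (fromℕ< p))
  ... | tri< _ _ _ = [ (- 1# , t) ]
  ... | tri≈ _ _ _ = []
  ... | tri> _ _ _ = [ (1# , swapLetters (fromℕ< (<-trans (n<1+n i) p)) (fromℕ< p) t) ]

  scale : Carrier → Comb → Comb
  scale a = map (λ { (b , t) → (a * b , t) })

  πbar : (i : ℕ) → suc i < n → Comb → Comb
  πbar i p = concatMap (λ { (a , t) → scale a (πbarBasis i p t) })

-- Only the rows x, y, z of the three letters i, i+1, i+2 matter: each π̄ either kills a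
-- term, multiplies it by -1, or exchanges two of x, y, z.  Both sides of the braid
-- relation therefore send {t} to 0 as soon as two of x, y, z coincide, and otherwise
-- to ± the tabloid whose three rows are x, y, z in increasing order, with the same
-- sign.  This is checked on the weak orderings of x, y, z.
module Submission where

open import Defs
open import Level using (Level)
open import Algebra.Bundles using (CommutativeRing)
import Algebra.Properties.CommutativeSemigroup as CommutativeSemigroupProperties
open import Data.Nat using (ℕ; suc; _<_)
open import Data.Nat.Properties using (<-trans; n<1+n; m<n⇒m<1+n)
import Data.Nat.Properties as ℕ
open import Data.Fin using (Fin; fromℕ<)
import Data.Fin as F
open import Data.Fin.Properties using (_≟_; <-cmp; fromℕ<-injective)
import Data.Fin.Properties as F
open import Data.Fin.Permutation.Components using (transpose)
open import Data.Vec using (Vec; lookup; _[_]≔_)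
open import Data.Vec.Properties using (lookup∘tabulate; tabulate∘lookup; tabulate-cong; lookup∘update; lookup∘update′; ≡-dec)
open import Data.List using ([]; [_])
open import Data.Product using (_,_)
open import Data.Empty using (⊥-elim)
open import Function using (_∘_)
open import Relation.Binary.Definitions using (Tri; tri<; tri≈; tri>)
open import Relation.Binary.PropositionalEquality using (_≡_; _≢_; _≗_; refl; sym; trans; cong; subst; subst₂)
open import Relation.Nullary using (yes; no)

transpose-matchˡ : ∀ {m} (a b : Fin m) → transpose a b a ≡ b
transpose-matchˡ a b with a ≟ a
... | yes _ = refl
... | no a≢a = ⊥-elim (a≢a refl)

transpose-matchʳ : ∀ {m} (a b : Fin m) → transpose a b b ≡ a
transpose-matchʳ a b with b ≟ a
... | yes b≡a = b≡a
... | no _ with b ≟ b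
...   | yes _ = refl
...   | no b≢b = ⊥-elim (b≢b refl)

transpose-other : ∀ {m} {a b q : Fin m} → q ≢ a → q ≢ b → transpose a b q ≡ q
transpose-other {a = a} {b} {q} q≢a q≢b with q ≟ a
... | yes q≡a = ⊥-elim (q≢a q≡a)
... | no _ with q ≟ b
...   | yes q≡b = ⊥-elim (q≢b q≡b)
...   | no _ = refl

fromℕ<-≢ : ∀ {j k n} .{j<n : j < n} .{k<n : k < n} → j ≢ k → fromℕ< j<n ≢ fromℕ< k<n
fromℕ<-≢ {j} {k} {j<n = j<n} {k<n} j≢k = j≢k ∘ fromℕ<-injective j k j<n k<n

lookup-extensionality : ∀ {A : Set} {m} {xs ys : Vec A m} → lookup xs ≗ lookup ys → xs ≡ ys
lookup-extensionality {xs = xs} {ys} eq =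
  trans (sym (tabulate∘lookup xs)) (trans (tabulate-cong eq) (tabulate∘lookup ys))

lookup-swapLetters : ∀ {ℓ n} (a b : Fin n) (s : RowFun ℓ n) (q : Fin n) →
  lookup (swapLetters a b s) q ≡ lookup s (transpose a b q)
lookup-swapLetters a b s = lookup∘tabulate _

module ThreeLetters {ℓ n : ℕ} {a b c : Fin n} (a≢b : a ≢ b) (a≢c : a ≢ c) (b≢c : b ≢ c)
                    (t : RowFun ℓ n) where

  place : Fin ℓ → Fin ℓ → Fin ℓ → RowFun ℓ n
  place x y z = ((t [ a ]≔ x) [ b ]≔ y) [ c ]≔ z

  module _ {x y z : Fin ℓ} where

    lookup-place-a : lookup (place x y z) a ≡ x
    lookup-place-a = trans (lookup∘update′ a≢c ((t [ a ]≔ x) [ b ]≔ y) z)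
                    (trans (lookup∘update′ a≢b (t [ a ]≔ x) y) (lookup∘update a t x))

    lookup-place-b : lookup (place x y z) b ≡ y
    lookup-place-b = trans (lookup∘update′ b≢c ((t [ a ]≔ x) [ b ]≔ y) z) (lookup∘update b (t [ a ]≔ x) y)

    lookup-place-c : lookup (place x y z) c ≡ z
    lookup-place-c = lookup∘update c ((t [ a ]≔ x) [ b ]≔ y) z

    lookup-place-other : ∀ {q} → q ≢ a → q ≢ b → q ≢ c → lookup (place x y z) q ≡ lookup t q
    lookup-place-other q≢a q≢b q≢c = trans (lookup∘update′ q≢c ((t [ a ]≔ x) [ b ]≔ y) z)
                                    (trans (lookup∘update′ q≢b (t [ a ]≔ x) y) (lookup∘update′ q≢a t x))

    ≡-place : ∀ {s} → lookup s a ≡ x → lookup s b ≡ y → lookup s c ≡ z →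
              (∀ {q} → q ≢ a → q ≢ b → q ≢ c → lookup s q ≡ lookup t q) → s ≡ place x y z
    ≡-place {s} sa sb sc others = lookup-extensionality pointwise
      where
      pointwise : lookup s ≗ lookup (place x y z)
      pointwise q with q ≟ a | q ≟ b | q ≟ c
      ... | yes refl | _ | _ = trans sa (sym lookup-place-a)
      ... | no _ | yes refl | _ = trans sb (sym lookup-place-b)
      ... | no _ | no _ | yes refl = trans sc (sym lookup-place-c)
      ... | no q≢a | no q≢b | no q≢c =
        trans (others q≢a q≢b q≢c) (sym (lookup-place-other q≢a q≢b q≢c))

  place-rows : place (lookup t a) (lookup t b) (lookup t c) ≡ t
  place-rows = sym (≡-place refl refl refl (λ _ _ _ → refl))

  swapLetters-ab-place : ∀ {x y z} → swapLetters a b (place x y z) ≡ place y x z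
  swapLetters-ab-place {x} {y} {z} = ≡-place
    (trans (transposed a) (trans (cong (lookup s) (transpose-matchˡ a b)) lookup-place-b))
    (trans (transposed b) (trans (cong (lookup s) (transpose-matchʳ a b)) lookup-place-a))
    (trans (transposed c) (trans (cong (lookup s) (transpose-other (a≢c ∘ sym) (b≢c ∘ sym))) lookup-place-c))
    (λ q≢a q≢b q≢c → trans (transposed _)
      (trans (cong (lookup s) (transpose-other q≢a q≢b)) (lookup-place-other q≢a q≢b q≢c)))
    where
    s : RowFun ℓ n
    s = place x y z
    transposed : ∀ q → lookup (swapLetters a b s) q ≡ lookup s (transpose a b q)
    transposed = lookup-swapLetters a b s

  swapLetters-bc-place : ∀ {x y z} → swapLetters b c (place x y z) ≡ place x z y
  swapLetters-bc-place {x} {y} {z} = ≡-place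
    (trans (transposed a) (trans (cong (lookup s) (transpose-other a≢b a≢c)) lookup-place-a))
    (trans (transposed b) (trans (cong (lookup s) (transpose-matchˡ b c)) lookup-place-c))
    (trans (transposed c) (trans (cong (lookup s) (transpose-matchʳ b c)) lookup-place-b))
    (λ q≢a q≢b q≢c → trans (transposed _)
      (trans (cong (lookup s) (transpose-other q≢b q≢c)) (lookup-place-other q≢a q≢b q≢c)))
    where
    s : RowFun ℓ n
    s = place x y z
    transposed : ∀ q → lookup (swapLetters b c s) q ≡ lookup s (transpose b c q)
    transposed = lookup-swapLetters b c s

module OneTerm {c ℓr : Level} (R : CommutativeRing c ℓr) (ℓ n i : ℕ) (p : suc i < n) where
  open Tabloids R ℓ n
  open CommutativeRing R using (Carrier; _*_; 1#; -_)

  lower upper : Fin n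
  lower = fromℕ< (<-trans (n<1+n i) p)
  upper = fromℕ< p

  module _ {k : Carrier} {s : RowFun ℓ n} where

    πbar-lowerRow : lookup s lower F.< lookup s upper → πbar i p [ (k , s) ] ≡ [ (k * - 1# , s) ]
    πbar-lowerRow lt with <-cmp (lookup s lower) (lookup s upper)
    ... | tri< _ _ _ = refl
    ... | tri≈ _ eq _ = ⊥-elim (F.<-irrefl eq lt)
    ... | tri> _ _ gt = ⊥-elim (F.<-asym lt gt)

    πbar-sameRow : lookup s lower ≡ lookup s upper → πbar i p [ (k , s) ] ≡ []
    πbar-sameRow eq with <-cmp (lookup s lower) (lookup s upper)
    ... | tri< lt _ _ = ⊥-elim (F.<-irrefl eq lt)
    ... | tri≈ _ _ _ = refl
    ... | tri> _ _ gt = ⊥-elim (F.<-irrefl (sym eq) gt)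

    πbar-higherRow : lookup s upper F.< lookup s lower →
                     πbar i p [ (k , s) ] ≡ [ (k * 1# , swapLetters lower upper s) ]
    πbar-higherRow gt with <-cmp (lookup s lower) (lookup s upper)
    ... | tri< lt _ _ = ⊥-elim (F.<-asym lt gt)
    ... | tri≈ _ eq _ = ⊥-elim (F.<-irrefl (sym eq) gt)
    ... | tri> _ _ _ = refl

module Braid {c ℓr : Level} (R : CommutativeRing c ℓr) {ℓ n : ℕ} (i : ℕ) (h : suc (suc i) < n)
             (t : RowFun ℓ n) where
  open Tabloids R ℓ n
  open CommutativeRing R using (Carrier; _≈_; _*_; 1#; -_; +-cong; *-congʳ; *-commutativeSemigroup)
    renaming (refl to ≈-refl; sym to ≈-sym; trans to ≈-trans)
  open CommutativeSemigroupProperties *-commutativeSemigroup using (xy∙z≈xz∙y)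

  p : suc i < n
  p = <-trans (n<1+n (suc i)) h

  π₁ π₂ : Comb → Comb
  π₁ = πbar i p
  π₂ = πbar (suc i) h

  Braided : Comb → Set ℓr
  Braided u = π₁ (π₂ (π₁ u)) ≋ π₂ (π₁ (π₂ u))

  open OneTerm R ℓ n i p using (πbar-lowerRow; πbar-sameRow; πbar-higherRow)
  open OneTerm R ℓ n (suc i) h using ()
    renaming (πbar-lowerRow to πbar₂-lowerRow; πbar-sameRow to πbar₂-sameRow; πbar-higherRow to πbar₂-higherRow)

  A B C : Fin n
  A = OneTerm.lower R ℓ n i p
  B = OneTerm.upper R ℓ n i p
  C = OneTerm.upper R ℓ n (suc i) h

  open ThreeLetters {a = A} {B} {C} (fromℕ<-≢ (ℕ.<⇒≢ (n<1+n i))) (fromℕ<-≢ (ℕ.<⇒≢ (m<n⇒m<1+n (n<1+n i))))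
                    (fromℕ<-≢ (ℕ.<⇒≢ (n<1+n (suc i)))) t

  term : Carrier → Fin ℓ → Fin ℓ → Fin ℓ → Comb
  term k x y z = [ (k , place x y z) ]

  module _ {k : Carrier} {x y z : Fin ℓ} where

    π₁-lower : x F.< y → π₁ (term k x y z) ≡ term (k * - 1#) x y z
    π₁-lower x<y = πbar-lowerRow (subst₂ F._<_ (sym lookup-place-a) (sym lookup-place-b) x<y)

    π₁-same : x ≡ y → π₁ (term k x y z) ≡ []
    π₁-same x≡y = πbar-sameRow (trans lookup-place-a (trans x≡y (sym lookup-place-b)))

    π₁-higher : y F.< x → π₁ (term k x y z) ≡ term (k * 1#) y x z
    π₁-higher y<x = trans (πbar-higherRow (subst₂ F._<_ (sym lookup-place-b) (sym lookup-place-a) y<x))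
                          (cong (λ s → [ (k * 1# , s) ]) swapLetters-ab-place)

    π₂-lower : y F.< z → π₂ (term k x y z) ≡ term (k * - 1#) x y z
    π₂-lower y<z = πbar₂-lowerRow (subst₂ F._<_ (sym lookup-place-b) (sym lookup-place-c) y<z)

    π₂-same : y ≡ z → π₂ (term k x y z) ≡ []
    π₂-same y≡z = πbar₂-sameRow (trans lookup-place-b (trans y≡z (sym lookup-place-c)))

    π₂-higher : z F.< y → π₂ (term k x y z) ≡ term (k * 1#) x z y
    π₂-higher z<y = trans (πbar₂-higherRow (subst₂ F._<_ (sym lookup-place-c) (sym lookup-place-b) z<y))
                          (cong (λ s → [ (k * 1# , s) ]) swapLetters-bc-place)

  term-cong : ∀ {a b x y z} → a ≈ b → term a x y z ≋ term b x y z
  term-cong {x = x} {y} {z} a≈b w with ≡-dec _≟_ (place x y z) w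
  ... | yes _ = +-cong a≈b ≈-refl
  ... | no _ = ≈-refl

  module _ {k : Carrier} {u v w : Fin ℓ} where

    π₁π₂π₁-≡ : ∀ {u₁ u₂ u₃} → π₁ (term k u v w) ≡ u₁ → π₂ u₁ ≡ u₂ → π₁ u₂ ≡ u₃ →
               π₁ (π₂ (π₁ (term k u v w))) ≡ u₃
    π₁π₂π₁-≡ e₁ e₂ e₃ = trans (cong (π₁ ∘ π₂) e₁) (trans (cong π₁ e₂) e₃)

    π₂π₁π₂-≡ : ∀ {u₁ u₂ u₃} → π₂ (term k u v w) ≡ u₁ → π₁ u₁ ≡ u₂ → π₂ u₂ ≡ u₃ →
               π₂ (π₁ (π₂ (term k u v w))) ≡ u₃
    π₂π₁π₂-≡ e₁ e₂ e₃ = trans (cong (π₂ ∘ π₁) e₁) (trans (cong π₂ e₂) e₃)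

    braided-vanishing : π₁ (π₂ (π₁ (term k u v w))) ≡ [] → π₂ (π₁ (π₂ (term k u v w))) ≡ [] →
                        Braided (term k u v w)
    braided-vanishing e₁ e₂ = subst₂ _≋_ (sym e₁) (sym e₂) (λ _ → ≈-refl)

    braided-reaching : ∀ {a b x y z} → π₁ (π₂ (π₁ (term k u v w))) ≡ term a x y z →
                       π₂ (π₁ (π₂ (term k u v w))) ≡ term b x y z → a ≈ b → Braided (term k u v w)
    braided-reaching e₁ e₂ a≈b = subst₂ _≋_ (sym e₁) (sym e₂) (term-cong a≈b)

  exchange-middle : ∀ k a b d → k * a * b * d ≈ k * b * a * d
  exchange-middle k a b d = *-congʳ (xy∙z≈xz∙y k a b)

  rotate-last : ∀ k a b d → k * a * b * d ≈ k * b * d * a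
  rotate-last k a b d = ≈-trans (exchange-middle k a b d) (xy∙z≈xz∙y (k * b) a d)

  braided-peak : ∀ k {u v w} → u F.< v → w F.< v → Tri (u F.< w) (u ≡ w) (w F.< u) → Braided (term k u v w)
  braided-peak k u<v w<v (tri< u<w _ _) = braided-reaching
    (π₁π₂π₁-≡ (π₁-lower u<v) (π₂-higher w<v) (π₁-lower u<w))
    (π₂π₁π₂-≡ (π₂-higher w<v) (π₁-lower u<w) (π₂-lower w<v))
    (exchange-middle k (- 1#) 1# (- 1#))
  braided-peak k u<v w<v (tri≈ _ u≡w _) = braided-vanishing
    (π₁π₂π₁-≡ (π₁-lower u<v) (π₂-higher w<v) (π₁-same u≡w))
    (π₂π₁π₂-≡ (π₂-higher w<v) (π₁-same u≡w) refl)
  braided-peak k u<v w<v (tri> _ _ w<u) = braided-reaching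
    (π₁π₂π₁-≡ (π₁-lower u<v) (π₂-higher w<v) (π₁-higher w<u))
    (π₂π₁π₂-≡ (π₂-higher w<v) (π₁-higher w<u) (π₂-lower u<v))
    (rotate-last k (- 1#) 1# 1#)

  braided-valley : ∀ k {u v w} → v F.< u → v F.< w → Tri (u F.< w) (u ≡ w) (w F.< u) → Braided (term k u v w)
  braided-valley k v<u v<w (tri< u<w _ _) = braided-reaching
    (π₁π₂π₁-≡ (π₁-higher v<u) (π₂-lower u<w) (π₁-lower v<u))
    (π₂π₁π₂-≡ (π₂-lower v<w) (π₁-higher v<u) (π₂-lower u<w))
    (exchange-middle k 1# (- 1#) (- 1#))
  braided-valley k v<u v<w (tri≈ _ u≡w _) = braided-vanishing
    (π₁π₂π₁-≡ (π₁-higher v<u) (π₂-same u≡w) refl)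
    (π₂π₁π₂-≡ (π₂-lower v<w) (π₁-higher v<u) (π₂-same u≡w))
  braided-valley k v<u v<w (tri> _ _ w<u) = braided-reaching
    (π₁π₂π₁-≡ (π₁-higher v<u) (π₂-higher w<u) (π₁-lower v<w))
    (π₂π₁π₂-≡ (π₂-lower v<w) (π₁-higher v<u) (π₂-higher w<u))
    (≈-sym (rotate-last k (- 1#) 1# 1#))

  braided-term : ∀ k {u v w} → Tri (u F.< v) (u ≡ v) (v F.< u) → Tri (v F.< w) (v ≡ w) (w F.< v) →
                 Braided (term k u v w)
  braided-term k (tri< u<v _ _) (tri< v<w _ _) = braided-reaching
    (π₁π₂π₁-≡ (π₁-lower u<v) (π₂-lower v<w) (π₁-lower u<v))
    (π₂π₁π₂-≡ (π₂-lower v<w) (π₁-lower u<v) (π₂-lower v<w))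
    ≈-refl
  braided-term k (tri< u<v _ _) (tri≈ _ v≡w _) = braided-vanishing
    (π₁π₂π₁-≡ (π₁-lower u<v) (π₂-same v≡w) refl)
    (π₂π₁π₂-≡ (π₂-same v≡w) refl refl)
  braided-term k {u} {w = w} (tri< u<v _ _) (tri> _ _ w<v) = braided-peak k u<v w<v (<-cmp u w)
  braided-term k (tri≈ _ u≡v _) (tri< v<w _ _) = braided-vanishing
    (π₁π₂π₁-≡ (π₁-same u≡v) refl refl)
    (π₂π₁π₂-≡ (π₂-lower v<w) (π₁-same u≡v) refl)
  braided-term k (tri≈ _ u≡v _) (tri≈ _ v≡w _) = braided-vanishing
    (π₁π₂π₁-≡ (π₁-same u≡v) refl refl)
    (π₂π₁π₂-≡ (π₂-same v≡w) refl refl)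
  braided-term k {w = w} (tri≈ _ u≡v _) (tri> _ _ w<v) = braided-vanishing
    (π₁π₂π₁-≡ (π₁-same u≡v) refl refl)
    (π₂π₁π₂-≡ (π₂-higher w<v) (π₁-higher (subst (w F.<_) (sym u≡v) w<v)) (π₂-same u≡v))
  braided-term k {u} {w = w} (tri> _ _ v<u) (tri< v<w _ _) = braided-valley k v<u v<w (<-cmp u w)
  braided-term k (tri> _ _ v<u) (tri≈ _ v≡w _) = braided-vanishing
    (π₁π₂π₁-≡ (π₁-higher v<u) (π₂-higher (subst (F._< _) v≡w v<u)) (π₁-same v≡w))
    (π₂π₁π₂-≡ (π₂-same v≡w) refl refl)
  braided-term k {u} {w = w} (tri> _ _ v<u) (tri> _ _ w<v) = braided-reaching
    (π₁π₂π₁-≡ (π₁-higher v<u) (π₂-higher w<u) (π₁-higher w<v))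
    (π₂π₁π₂-≡ (π₂-higher w<v) (π₁-higher w<u) (π₂-higher v<u))
    ≈-refl
    where
    w<u : w F.< u
    w<u = F.<-trans w<v v<u

  braided-basis : Braided (basis t)
  braided-basis = subst (Braided ∘ basis) place-rows
    (braided-term 1# (<-cmp (lookup t A) (lookup t B)) (<-cmp (lookup t B) (lookup t C)))

proposition3 : {c ℓr : Level} (R : CommutativeRing c ℓr) {ℓ : ℕ} (λ' : Vec ℕ ℓ) (n : ℕ) →
    IsPartition λ' n →
    (i : ℕ) (h : suc (suc i) < n) (t : RowFun ℓ n) → IsTabloid λ' t →
    let open Tabloids R ℓ n
        p = <-trans (n<1+n (suc i)) h
    in πbar i p (πbar (suc i) h (πbar i p (basis t)))
       ≋ πbar (suc i) h (πbar i p (πbar (suc i) h (basis t)))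
proposition3 R λ' n _ i h t _ = Braid.braided-basis R i h t
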